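{- Let $N = q^k n^2$ be an odd perfect number given in Eulerian form. Define $G = \gcd(\sigma(q^k),\sigma(n^2))$, $H = \gcd(n^2,\sigma(n^2))$ and $I = \gcd(n,\sigma(n^2))$. Then $G$ divides $I$ and $I$ divides $H$.
   Context: $\sigma(x)$ denotes the sum of the positive divisors of $x$. A positive integer $N$ is perfect if $\sigma(N)=2N$. An odd perfect number $N$ is said to be given in Eulerian form $N = q^k n^2$ if $q$ is a prime (the special prime), $k$ and $n$ are positive integers, $q \equiv k \equiv 1 \pmod 4$, and $\gcd(q,n)=1$. -}

module Defs where

open import Data.Nat using (ℕ; suc; _+_; _*_; _^_; _∸_)
open import Data.Nat.Divisibility using (_∣_; _∣?_)
open import Data.Nat.GCD using (gcd)
open import Data.Nat.Primality using (Prime)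
open import Data.Nat.DivMod using (_%_)
open import Data.List using (List; map; filter; upTo)
open import Data.Nat.ListAction using (sum)
open import Data.Product using (_×_)
open import Relation.Binary.PropositionalEquality using (_≡_)
open import Relation.Nullary using (¬_)

σ : ℕ → ℕ
σ x = sum (filter (λ d → d ∣? x) (map suc (upTo x)))

Perfect : ℕ → Set
Perfect N = (0 Data.Nat.< N) × (σ N ≡ 2 * N)

Odd : ℕ → Set
Odd N = ¬ (2 ∣ N)

EulerianForm : ℕ → ℕ → ℕ → ℕ → Set
EulerianForm N q k n =
  Perfect N × Odd N × (N ≡ q ^ k * n ^ 2) × Prime q
  × (0 Data.Nat.< k) × (0 Data.Nat.< n)
  × (q % 4 ≡ 1) × (k % 4 ≡ 1) × (gcd q n ≡ 1)

-- Since q ∤ n², the divisors of q^k·n² split as products, so σ(q^k)·σ(n²) = σ(N) = 2·q^k·n².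
-- As σ(q^k) ≡ 1 (mod q), G is prime to q, hence G² ∣ 2·n², and 2 being squarefree this
-- forces G ∣ n.  Together with G ∣ σ(n²) this gives G ∣ I; and I ∣ H simply because n ∣ n².
module Submission where

open import Data.Empty using (⊥-elim)
open import Data.List using ([_]; _++_; map; filter; upTo)
open import Data.List.Properties using (map-++; filter-++; upTo-∷ʳ)
open import Data.Nat
open import Data.Nat.Coprimality as Coprime using (Coprime; coprime-divisor; gcd≡1⇒coprime; coprime-/gcd)
open import Data.Nat.DivMod using (_/_; m*[n/m]≡n)
open import Data.Nat.Divisibility
open import Data.Nat.GCD using (gcd; gcd[m,n]∣m; gcd[m,n]∣n; gcd-greatest; gcd[m,n]≢0)
open import Data.Nat.ListAction using (sum)
open import Data.Nat.ListAction.Properties using (sum-++)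
open import Data.Nat.Primality using (Prime; prime⇒irreducible; prime⇒nonZero; prime⇒nonTrivial; euclidsLemma)
open import Data.Nat.Properties
open import Data.Nat.Tactic.RingSolver using (solve-∀)
open import Data.Product using (_×_; _,_)
open import Data.Sum using (inj₁; inj₂; reduce)
open import Relation.Binary.PropositionalEquality hiding ([_])
open import Relation.Nullary using (Dec; yes; no)

open import Defs

sumTo : (ℕ → ℕ) → ℕ → ℕ
sumTo f zero = 0
sumTo f (suc n) = sumTo f n + f (suc n)

sumTo-cong : ∀ {f g} → (∀ d → f d ≡ g d) → ∀ n → sumTo f n ≡ sumTo g n
sumTo-cong f≗g zero = refl
sumTo-cong f≗g (suc n) = cong₂ _+_ (sumTo-cong f≗g n) (f≗g (suc n))

sumTo-zero : ∀ {f} n → (∀ i → i < n → f (suc i) ≡ 0) → sumTo f n ≡ 0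
sumTo-zero zero _ = refl
sumTo-zero (suc n) f≡0 =
  cong₂ _+_ (sumTo-zero n (λ i i<n → f≡0 i (m<n⇒m<1+n i<n))) (f≡0 n ≤-refl)

sumTo-+ : ∀ f g n → sumTo (λ d → f d + g d) n ≡ sumTo f n + sumTo g n
sumTo-+ f g zero = refl
sumTo-+ f g (suc n) rewrite sumTo-+ f g n = interchange (sumTo f n) (sumTo g n) (f (suc n)) (g (suc n))
  where
  interchange : ∀ a b c d → a + b + (c + d) ≡ a + c + (b + d)
  interchange = solve-∀

sumTo-* : ∀ c f n → sumTo (λ d → c * f d) n ≡ c * sumTo f n
sumTo-* c f zero = sym (*-zeroʳ c)
sumTo-* c f (suc n) rewrite sumTo-* c f n = sym (*-distribˡ-+ c (sumTo f n) (f (suc n)))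

sumTo-split : ∀ f m n → sumTo f (m + n) ≡ sumTo f m + sumTo (λ d → f (m + d)) n
sumTo-split f m zero rewrite +-identityʳ m = sym (+-identityʳ (sumTo f m))
sumTo-split f m (suc n) rewrite +-suc m n | sumTo-split f m n =
  +-assoc (sumTo f m) (sumTo (λ d → f (m + d)) n) _

onMultiplesOf : ℕ → (ℕ → ℕ) → ℕ → ℕ
onMultiplesOf q f d with q ∣? d
... | yes _ = f d
... | no  _ = 0

offMultiplesOf : ℕ → (ℕ → ℕ) → ℕ → ℕ
offMultiplesOf q f d with q ∣? d
... | yes _ = 0
... | no  _ = f d

onMultiplesOf-∣ : ∀ {q d} f → q ∣ d → onMultiplesOf q f d ≡ f d
onMultiplesOf-∣ {q} {d} f q∣d with q ∣? d
... | yes _   = refl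
... | no  q∤d = ⊥-elim (q∤d q∣d)

onMultiplesOf-∤ : ∀ {q d} f → q ∤ d → onMultiplesOf q f d ≡ 0
onMultiplesOf-∤ {q} {d} f q∤d with q ∣? d
... | yes q∣d = ⊥-elim (q∤d q∣d)
... | no  _   = refl

on+offMultiplesOf : ∀ q f d → f d ≡ onMultiplesOf q f d + offMultiplesOf q f d
on+offMultiplesOf q f d with q ∣? d
... | yes _ = sym (+-identityʳ (f d))
... | no  _ = refl

∤-between-multiples : ∀ q y i → suc i < q → q ∤ q * y + suc i
∤-between-multiples q y i i<q q∣ = <⇒≱ i<q (∣⇒≤ (∣m+n∣m⇒∣n q∣ (m∣m*n y)))

sumTo-onMultiplesOf : ∀ q .{{_ : NonZero q}} f y →
  sumTo (onMultiplesOf q f) (q * y) ≡ sumTo (λ j → f (q * j)) y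
sumTo-onMultiplesOf q f zero rewrite *-zeroʳ q = refl
sumTo-onMultiplesOf q@(suc p) f (suc y) = begin
  sumTo g (q * suc y)                                  ≡⟨ cong (sumTo g) (trans (*-suc q y) (+-comm q (q * y))) ⟩
  sumTo g (q * y + q)                                  ≡⟨ sumTo-split g (q * y) q ⟩
  sumTo g (q * y) + sumTo (λ d → g (q * y + d)) q      ≡⟨ cong₂ _+_ (sumTo-onMultiplesOf q f y) lastBlock ⟩
  sumTo (λ j → f (q * j)) y + f (q * suc y)            ∎
  where
  open ≡-Reasoning
  g : ℕ → ℕ
  g = onMultiplesOf q f
  q*y+q≡q*[1+y] : q * y + q ≡ q * suc y
  q*y+q≡q*[1+y] = trans (+-comm (q * y) q) (sym (*-suc q y))
  lastBlock : sumTo (λ d → g (q * y + d)) q ≡ f (q * suc y)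
  lastBlock = begin
    sumTo (λ d → g (q * y + d)) p + g (q * y + q)
      ≡⟨ cong (_+ g (q * y + q)) (sumTo-zero p λ i i<p →
           onMultiplesOf-∤ f (∤-between-multiples q y i (s≤s i<p))) ⟩
    g (q * y + q)
      ≡⟨ onMultiplesOf-∣ f (subst (q ∣_) (sym q*y+q≡q*[1+y]) (m∣m*n (suc y))) ⟩
    f (q * y + q)
      ≡⟨ cong f q*y+q≡q*[1+y] ⟩
    f (q * suc y) ∎

σ-summand : ℕ → ℕ → ℕ
σ-summand x d with d ∣? x
... | yes _ = d
... | no  _ = 0

σ-summand-∣ : ∀ {x d} → d ∣ x → σ-summand x d ≡ d
σ-summand-∣ {x} {d} d∣x with d ∣? x
... | yes _   = refl
... | no  d∤x = ⊥-elim (d∤x d∣x)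

σ-summand-∤ : ∀ {x d} → d ∤ x → σ-summand x d ≡ 0
σ-summand-∤ {x} {d} d∤x with d ∣? x
... | yes d∣x = ⊥-elim (d∤x d∣x)
... | no  _   = refl

σ-summand-cong : ∀ {x y d} → (d ∣ x → d ∣ y) → (d ∣ y → d ∣ x) → σ-summand x d ≡ σ-summand y d
σ-summand-cong {x} {y} {d} x⇒y y⇒x with d ∣? y
... | yes d∣y = σ-summand-∣ (y⇒x d∣y)
... | no  d∤y = σ-summand-∤ (λ d∣x → d∤y (x⇒y d∣x))

σ-summand-* : ∀ q .{{_ : NonZero q}} y d → σ-summand (q * y) (q * d) ≡ q * σ-summand y d
σ-summand-* q y d with d ∣? y
... | yes d∣y = σ-summand-∣ (*-monoʳ-∣ q d∣y)
... | no  d∤y = trans (σ-summand-∤ (λ qd∣qy → d∤y (*-cancelˡ-∣ q qd∣qy))) (sym (*-zeroʳ q))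

σ≡sumTo : ∀ x → σ x ≡ sumTo (σ-summand x) x
σ≡sumTo x = divisorsUpTo x
  where
  open ≡-Reasoning
  P : ∀ d → Dec (d ∣ x)
  P d = d ∣? x
  filter-singleton : ∀ d → sum (filter P [ d ]) ≡ σ-summand x d
  filter-singleton d with d ∣? x
  ... | yes _ = +-identityʳ d
  ... | no  _ = refl
  divisorsUpTo : ∀ n → sum (filter P (map suc (upTo n))) ≡ sumTo (σ-summand x) n
  divisorsUpTo zero = refl
  divisorsUpTo (suc n) = begin
    sum (filter P (map suc (upTo (suc n))))
      ≡⟨ cong (λ l → sum (filter P (map suc l))) (sym (upTo-∷ʳ n)) ⟩
    sum (filter P (map suc (upTo n ++ [ n ])))
      ≡⟨ cong (λ l → sum (filter P l)) (map-++ suc (upTo n) [ n ]) ⟩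
    sum (filter P (map suc (upTo n) ++ [ suc n ]))
      ≡⟨ cong sum (filter-++ P (map suc (upTo n)) [ suc n ]) ⟩
    sum (filter P (map suc (upTo n)) ++ filter P [ suc n ])
      ≡⟨ sum-++ (filter P (map suc (upTo n))) (filter P [ suc n ]) ⟩
    sum (filter P (map suc (upTo n))) + sum (filter P [ suc n ])
      ≡⟨ cong₂ _+_ (divisorsUpTo n) (filter-singleton (suc n)) ⟩
    sumTo (σ-summand x) n + σ-summand x (suc n) ∎

σ≡sumTo-beyond : ∀ x .{{_ : NonZero x}} {b} → x ≤ b → σ x ≡ sumTo (σ-summand x) b
σ≡sumTo-beyond x {b} x≤b = begin
  σ x                                                                ≡⟨ σ≡sumTo x ⟩
  sumTo (σ-summand x) x                                              ≡⟨ sym (+-identityʳ _) ⟩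
  sumTo (σ-summand x) x + 0                                          ≡⟨ cong (_ +_) (sym tail≡0) ⟩
  sumTo (σ-summand x) x + sumTo (λ d → σ-summand x (x + d)) (b ∸ x)  ≡⟨ sym (sumTo-split _ x (b ∸ x)) ⟩
  sumTo (σ-summand x) (x + (b ∸ x))                                  ≡⟨ cong (sumTo _) (m+[n∸m]≡n x≤b) ⟩
  sumTo (σ-summand x) b                                              ∎
  where
  open ≡-Reasoning
  tail≡0 : sumTo (λ d → σ-summand x (x + d)) (b ∸ x) ≡ 0
  tail≡0 = sumTo-zero (b ∸ x) λ i _ → σ-summand-∤ λ x+1+i∣x →
    <⇒≱ (m<m+n x z<s) (∣⇒≤ x+1+i∣x)

prime∤1 : ∀ {p} → Prime p → p ∤ 1
prime∤1 {p} pr p∣1 with ∣1⇒≡1 p∣1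
... | refl = nonTrivial⇒≢1 {{prime⇒nonTrivial pr}} refl

prime∤⇒coprime : ∀ {p d} → Prime p → p ∤ d → Coprime d p
prime∤⇒coprime pr p∤d (e∣d , e∣p) with prime⇒irreducible pr e∣p
... | inj₁ e≡1 = e≡1
... | inj₂ refl = ⊥-elim (p∤d e∣d)

coprime-∣^* : ∀ {d q m} → Coprime d q → ∀ k → d ∣ q ^ k * m → d ∣ m
coprime-∣^* {d} {q} {m} d⊥q zero d∣m = subst (d ∣_) (*-identityˡ m) d∣m
coprime-∣^* {d} {q} {m} d⊥q (suc k) d∣ =
  coprime-∣^* d⊥q k (coprime-divisor d⊥q (subst (d ∣_) (*-assoc q (q ^ k) m) d∣))

offMultiplesOf-σ-summand : ∀ {q m} → Prime q → q ∤ m → ∀ j d →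
  offMultiplesOf q (σ-summand (q ^ j * m)) d ≡ σ-summand m d
offMultiplesOf-σ-summand {q} {m} pr q∤m j d with q ∣? d
... | yes q∣d = sym (σ-summand-∤ (λ d∣m → q∤m (∣-trans q∣d d∣m)))
... | no  q∤d = σ-summand-cong (coprime-∣^* (prime∤⇒coprime pr q∤d) j) (∣n⇒∣m*n (q ^ j))

-- Divisors of q^(k+1)·m are either q·d with d ∣ q^k·m, or prime to q and then divisors of m.
σ-prime-power-*-suc : ∀ {q m} .{{_ : NonZero m}} → Prime q → q ∤ m → ∀ k →
  σ (q ^ suc k * m) ≡ q * σ (q ^ k * m) + σ m
σ-prime-power-*-suc {q} {m} pr q∤m k = begin
  σ x                                                         ≡⟨ σ≡sumTo x ⟩
  sumTo (σ-summand x) x                                       ≡⟨ sumTo-cong (on+offMultiplesOf q (σ-summand x)) x ⟩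
  sumTo (λ d → onMultiplesOf q (σ-summand x) d + offMultiplesOf q (σ-summand x) d) x
                                                              ≡⟨ sumTo-+ _ _ x ⟩
  sumTo (onMultiplesOf q (σ-summand x)) x + sumTo (offMultiplesOf q (σ-summand x)) x
                                                              ≡⟨ cong₂ _+_ multiples nonMultiples ⟩
  q * σ y + σ m                                               ∎
  where
  open ≡-Reasoning
  instance
    q≢0 : NonZero q
    q≢0 = prime⇒nonZero pr
  y x : ℕ
  y = q ^ k * m
  x = q ^ suc k * m
  multiples : sumTo (onMultiplesOf q (σ-summand x)) x ≡ q * σ y
  multiples = begin
    sumTo (onMultiplesOf q (σ-summand x)) x
      ≡⟨ cong (λ z → sumTo (onMultiplesOf q (σ-summand z)) z) (*-assoc q (q ^ k) m) ⟩
    sumTo (onMultiplesOf q (σ-summand (q * y))) (q * y)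
      ≡⟨ sumTo-onMultiplesOf q (σ-summand (q * y)) y ⟩
    sumTo (λ j → σ-summand (q * y) (q * j)) y
      ≡⟨ sumTo-cong (σ-summand-* q y) y ⟩
    sumTo (λ j → q * σ-summand y j) y
      ≡⟨ sumTo-* q (σ-summand y) y ⟩
    q * sumTo (σ-summand y) y
      ≡⟨ cong (q *_) (sym (σ≡sumTo y)) ⟩
    q * σ y ∎
  nonMultiples : sumTo (offMultiplesOf q (σ-summand x)) x ≡ σ m
  nonMultiples = begin
    sumTo (offMultiplesOf q (σ-summand x)) x   ≡⟨ sumTo-cong (offMultiplesOf-σ-summand pr q∤m (suc k)) x ⟩
    sumTo (σ-summand m) x                      ≡⟨ sym (σ≡sumTo-beyond m (m≤n*m m (q ^ suc k) {{m^n≢0 q (suc k)}})) ⟩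
    σ m                                        ∎

σ-prime-power-suc : ∀ {q} → Prime q → ∀ k → σ (q ^ suc k) ≡ q * σ (q ^ k) + 1
σ-prime-power-suc {q} pr k = begin
  σ (q ^ suc k)              ≡⟨ cong σ (sym (*-identityʳ (q ^ suc k))) ⟩
  σ (q ^ suc k * 1)          ≡⟨ σ-prime-power-*-suc pr (prime∤1 pr) k ⟩
  q * σ (q ^ k * 1) + 1      ≡⟨ cong (λ z → q * σ z + 1) (*-identityʳ (q ^ k)) ⟩
  q * σ (q ^ k) + 1          ∎
  where open ≡-Reasoning

σ-multiplicative-prime-power : ∀ {q m} .{{_ : NonZero m}} → Prime q → q ∤ m → ∀ k →
  σ (q ^ k * m) ≡ σ (q ^ k) * σ m
σ-multiplicative-prime-power {q} {m} pr q∤m zero = trans (cong σ (*-identityˡ m)) (sym (*-identityˡ (σ m)))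
σ-multiplicative-prime-power {q} {m} pr q∤m (suc k) = begin
  σ (q ^ suc k * m)              ≡⟨ σ-prime-power-*-suc pr q∤m k ⟩
  q * σ (q ^ k * m) + σ m        ≡⟨ cong (λ z → q * z + σ m) (σ-multiplicative-prime-power pr q∤m k) ⟩
  q * (σ (q ^ k) * σ m) + σ m    ≡⟨ factor q (σ (q ^ k)) (σ m) ⟩
  (q * σ (q ^ k) + 1) * σ m      ≡⟨ cong (_* σ m) (sym (σ-prime-power-suc pr k)) ⟩
  σ (q ^ suc k) * σ m            ∎
  where
  open ≡-Reasoning
  factor : ∀ a b c → a * (b * c) + c ≡ (a * b + 1) * c
  factor = solve-∀

prime∤σ[prime^k] : ∀ {q} → Prime q → ∀ k → q ∤ σ (q ^ k)
prime∤σ[prime^k] pr zero = prime∤1 pr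
prime∤σ[prime^k] {q} pr (suc k) q∣σ =
  prime∤1 pr (∣m+n∣m⇒∣n (subst (q ∣_) (σ-prime-power-suc pr k) q∣σ) (m∣m*n (σ (q ^ k))))

coprime-*ʳ : ∀ {a b c} → Coprime a b → Coprime a c → Coprime a (b * c)
coprime-*ʳ a⊥b a⊥c (e∣a , e∣bc) =
  a⊥c (e∣a , coprime-divisor (λ (f∣e , f∣b) → a⊥b (∣-trans f∣e e∣a , f∣b)) e∣bc)

coprime-square : ∀ {a b} → Coprime a b → Coprime (a * a) (b * b)
coprime-square {a} {b} a⊥b = Coprime.sym (coprime-*ʳ b*b⊥a b*b⊥a)
  where
  b*b⊥a : Coprime (b * b) a
  b*b⊥a = Coprime.sym (coprime-*ʳ a⊥b a⊥b)

n*n∣2⇒n≡1 : ∀ n → n * n ∣ 2 → n ≡ 1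
n*n∣2⇒n≡1 zero 0∣2 with () ← 0∣⇒≡0 0∣2
n*n∣2⇒n≡1 (suc zero) _ = refl
n*n∣2⇒n≡1 (suc (suc n)) n*n∣2
  with ≤-trans (*-mono-≤ {2} {2 + n} {2} {2 + n} (s≤s (s≤s z≤n)) (s≤s (s≤s z≤n))) (∣⇒≤ n*n∣2)
... | s≤s (s≤s ())

-- Divide out g = gcd m n: the cofactors a, b are coprime, so a² ∣ 2 b² forces a² ∣ 2.
m*m∣2*[n*n]⇒m∣n : ∀ m n → m * m ∣ 2 * (n * n) → m ∣ n
m*m∣2*[n*n]⇒m∣n m zero _ = m ∣0
m*m∣2*[n*n]⇒m∣n m n@(suc _) m*m∣2*n*n = subst (_∣ n) (sym m≡g) (gcd[m,n]∣n m n)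
  where
  g : ℕ
  g = gcd m n
  instance
    g≢0 : NonZero g
    g≢0 = ≢-nonZero (gcd[m,n]≢0 m n (inj₂ λ ()))
  a b : ℕ
  a = m / g
  b = n / g
  a⊥b : Coprime a b
  a⊥b = coprime-/gcd m n
  m≡g*a : m ≡ g * a
  m≡g*a = sym (m*[n/m]≡n (gcd[m,n]∣m m n))
  n≡g*b : n ≡ g * b
  n≡g*b = sym (m*[n/m]≡n (gcd[m,n]∣n m n))
  square-* : ∀ g a → (g * a) * (g * a) ≡ (g * g) * (a * a)
  square-* = solve-∀
  twice-square-* : ∀ g b → 2 * ((g * b) * (g * b)) ≡ (g * g) * ((b * b) * 2)
  twice-square-* = solve-∀
  g*g*[a*a]∣g*g*[b*b*2] : (g * g) * (a * a) ∣ (g * g) * ((b * b) * 2)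
  g*g*[a*a]∣g*g*[b*b*2] = subst₂ _∣_
    (trans (cong (λ z → z * z) m≡g*a) (square-* g a))
    (trans (cong (λ z → 2 * (z * z)) n≡g*b) (twice-square-* g b)) m*m∣2*n*n
  a≡1 : a ≡ 1
  a≡1 = n*n∣2⇒n≡1 a (coprime-divisor (coprime-square a⊥b) (*-cancelˡ-∣ (g * g) {{m*n≢0 g g}} g*g*[a*a]∣g*g*[b*b*2]))
  m≡g : m ≡ g
  m≡g = trans m≡g*a (trans (cong (g *_) a≡1) (*-identityʳ g))

gcd[σ[q^k],σ[n²]]∣n : ∀ {q n} .{{_ : NonZero n}} → Prime q → q ∤ n ^ 2 → ∀ k →
  σ (q ^ k * n ^ 2) ≡ 2 * (q ^ k * n ^ 2) → gcd (σ (q ^ k)) (σ (n ^ 2)) ∣ n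
gcd[σ[q^k],σ[n²]]∣n {q} {n} q-prime q∤n² k σ≡2* =
  m*m∣2*[n*n]⇒m∣n G n (coprime-∣^* G*G⊥q k (subst (G * G ∣_) σ[q^k]*σ[n²] (*-pres-∣ G∣σ[q^k] G∣σ[n²])))
  where
  instance
    n²≢0 : NonZero (n ^ 2)
    n²≢0 = m^n≢0 n 2
  G : ℕ
  G = gcd (σ (q ^ k)) (σ (n ^ 2))
  G∣σ[q^k] : G ∣ σ (q ^ k)
  G∣σ[q^k] = gcd[m,n]∣m (σ (q ^ k)) (σ (n ^ 2))
  G∣σ[n²] : G ∣ σ (n ^ 2)
  G∣σ[n²] = gcd[m,n]∣n (σ (q ^ k)) (σ (n ^ 2))
  G*G⊥q : Coprime (G * G) q
  G*G⊥q = prime∤⇒coprime q-prime λ q∣G*G → prime∤σ[prime^k] q-prime k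
    (∣-trans (reduce (euclidsLemma G G q-prime q∣G*G)) G∣σ[q^k])
  rearrange : ∀ a n → 2 * (a * (n * (n * 1))) ≡ a * (2 * (n * n))
  rearrange = solve-∀
  σ[q^k]*σ[n²] : σ (q ^ k) * σ (n ^ 2) ≡ q ^ k * (2 * (n * n))
  σ[q^k]*σ[n²] = begin
    σ (q ^ k) * σ (n ^ 2)   ≡⟨ sym (σ-multiplicative-prime-power q-prime q∤n² k) ⟩
    σ (q ^ k * n ^ 2)       ≡⟨ σ≡2* ⟩
    2 * (q ^ k * n ^ 2)     ≡⟨ rearrange (q ^ k) n ⟩
    q ^ k * (2 * (n * n))   ∎
    where open ≡-Reasoning

lemma2 : (N q k n : ℕ) → EulerianForm N q k n →
    (gcd (σ (q ^ k)) (σ (n ^ 2)) ∣ gcd n (σ (n ^ 2)))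
    × (gcd n (σ (n ^ 2)) ∣ gcd (n ^ 2) (σ (n ^ 2)))
lemma2 N q k n ((_ , σN≡2N) , _ , N≡q^k*n² , q-prime , _ , 0<n , _ , _ , gcd[q,n]≡1) =
  gcd-greatest G∣n (gcd[m,n]∣n (σ (q ^ k)) _) , gcd-greatest I∣n² (gcd[m,n]∣n n _)
  where
  instance
    n≢0 : NonZero n
    n≢0 = >-nonZero 0<n
  q∤n² : q ∤ n ^ 2
  q∤n² q∣n² = prime∤1 q-prime (coprime-divisor q⊥n (coprime-divisor q⊥n q∣n²))
    where
    q⊥n : Coprime q n
    q⊥n = gcd≡1⇒coprime gcd[q,n]≡1
  G∣n : gcd (σ (q ^ k)) (σ (n ^ 2)) ∣ n
  G∣n = gcd[σ[q^k],σ[n²]]∣n q-prime q∤n² k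
    (subst (λ M → σ M ≡ 2 * M) N≡q^k*n² σN≡2N)
  I∣n² : gcd n (σ (n ^ 2)) ∣ n ^ 2
  I∣n² = ∣-trans (gcd[m,n]∣m n _) (m∣m*n (n * 1))
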